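{- For every $\alpha$ with $3\le\alpha\le\omega$, the set $\mathsf{W}^N_3$ is first-order definable (without parameters) in the structure $(\mathsf{W}^N_\alpha,\prec,\Diamond_1,\Diamond_3)$.
   Context: A word is a finite string over $\mathbb{N}$; $\Lambda$ is the empty word, $AB$ is concatenation. $\mathsf{S}_k$ is the set of words all of whose symbols are $\ge k$; $\mathsf{W}_\alpha$ is the set of words all of whose symbols are $\le\alpha$. A relation $\precsim$ on words is defined by induction on (maximal symbol minus minimal symbol) of $AB$: $\Lambda\precsim\Lambda$; if $AB$ is nonempty with minimal symbol $n$, write uniquely $A=A_1n\dots nA_k$, $B=B_1n\dots nB_l$ with $k,l\ge1$ and all $A_i,B_j\in\mathsf{S}_{n+1}$; let $(C_i)$, $(D_j)$ be lexicographically maximal subsequences of $(A_1,\dots,A_k)$, $(B_1,\dots,B_l)$; then $A\precsim B$ iff $(C_i)$ is lexicographically not greater than $(D_j)$. Here $(X_1,\dots,X_p)$ is lexicographically not greater than $(Y_1,\dots,Y_q)$ iff either $p\le q$ and $X_i\sim Y_i$ for all $i\le p$, or there is $s<\min(p,q)$ with $X_i\sim Y_i$ for $i\le s$ and $X_{s+1}\precsim Y_{s+1}$; a lexicographically maximal subsequence is one lexicographically not less than every subsequence. $A\sim B$ iff $A\precsim B$ and $B\precsim A$; $A\prec B$ iff $A\precsim B$ and not $B\precsim A$. $\mathsf{NF}$: $\Lambda\in\mathsf{NF}$; a nonempty word with minimal symbol $n$, written $A_1n\dots nA_k$ with $k\ge2$, $A_i\in\mathsf{S}_{n+1}$, is in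 $\mathsf{NF}$ iff $A_k\precsim\dots\precsim A_1$ and all $A_i\in\mathsf{NF}$. Every word is equivalent to exactly one word of $\mathsf{NF}$. For $A\in\mathsf{NF}$, $\Diamond_nA$ is the unique word of $\mathsf{NF}$ equivalent to $An$. $\mathsf{W}^N_\alpha=\mathsf{W}_\alpha\cap\mathsf{NF}$. -}

module Defs where

open import Data.Nat using (ℕ; zero; suc; _≤_; _⊔_; _⊓_; _≟_)
open import Data.List using (List; []; _∷_; _++_; foldr; [_])
open import Data.List.Relation.Unary.All using (All)
open import Data.List.Relation.Unary.Linked using (Linked)
open import Data.List.Relation.Binary.Sublist.Propositional using (_⊆_)
open import Data.Product using (Σ; _×_; _,_; proj₁; proj₂)
open import Data.Unit using (⊤)
open import Data.Empty using (⊥)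
import Data.Sum
import Data.Vec
open import Data.Fin using (Fin)
open import Data.Vec using (Vec; lookup; _∷_)
open import Relation.Nullary using (¬_; yes; no)
open import Relation.Binary.PropositionalEquality using (_≡_)

Word : Set
Word = List ℕ

minW : ℕ → Word → ℕ
minW x xs = foldr _⊓_ x xs

maxW : Word → ℕ
maxW = foldr _⊔_ 0

-- split n A = (A₁ , … , A_k)  where  A = A₁ n A₂ n … n A_k  (k ≥ 1)
splitAux : ℕ → Word → Word × List Word
splitAux n [] = [] , []
splitAux n (x ∷ xs) with x ≟ n
... | yes _ = [] , (proj₁ (splitAux n xs) ∷ proj₂ (splitAux n xs))
... | no  _ = (x ∷ proj₁ (splitAux n xs)) , proj₂ (splitAux n xs)

split : ℕ → Word → List Word
split n A = proj₁ (splitAux n A) ∷ proj₂ (splitAux n A)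

-- Leq f A B is the paper's A ≾ B whenever f > (max − min) of AB;
-- recursive calls are only on words from S_{n+1}, whose spread is smaller.

mutual
  Leq : ℕ → Word → Word → Set
  Leq zero A B = ⊤
  Leq (suc f) A B with A ++ B
  ... | [] = ⊤
  ... | x ∷ xs =
    Σ (List Word) λ C → Σ (List Word) λ D →
      C ⊆ split (minW x xs) A × D ⊆ split (minW x xs) B
      × (∀ S → S ⊆ split (minW x xs) A → LexLeq f S C)
      × (∀ S → S ⊆ split (minW x xs) B → LexLeq f S D)
      × LexLeq f C D

  LexLeq : ℕ → List Word → List Word → Set
  LexLeq f [] ys = ⊤
  LexLeq f (x ∷ xs) [] = ⊥
  LexLeq f (x ∷ xs) (y ∷ ys) =
    (Leq f x y × Leq f y x × LexLeq f xs ys)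
    Data.Sum.⊎ (Leq f x y × ¬ Leq f y x)

_≾_ : Word → Word → Set
A ≾ B = Leq (suc (maxW (A ++ B))) A B

_∼_ : Word → Word → Set
A ∼ B = (A ≾ B) × (B ≾ A)

_≺_ : Word → Word → Set
A ≺ B = (A ≾ B) × ¬ (B ≾ A)

data NF : Word → Set where
  nfΛ : NF []
  nf∷ : ∀ {x xs} →
        All NF (split (minW x xs) (x ∷ xs)) →
        Linked (λ P Q → Q ≾ P) (split (minW x xs) (x ∷ xs)) →
        NF (x ∷ xs)

data Bound : Set where
  fin : ℕ → Bound
  ω   : Bound

data ThreeLe : Bound → Set where
  le-fin : ∀ {a} → 3 ≤ a → ThreeLe (fin a)
  le-ω   : ThreeLe ω

InW : Bound → Word → Set
InW (fin a) A = All (_≤ a) A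
InW ω A = ⊤

record Elem (α : Bound) : Set where
  constructor elem
  field
    word : Word
    isNF : NF word
    inW  : InW α word
open Elem public

record Structure : Set₁ where
  field
    D    : Set
    Eq   : D → D → Set
    Lt   : D → D → Set
    dia₁ : D → D
    dia₃ : D → D

data Term (n : ℕ) : Set where
  var : Fin n → Term n
  ◇₁  : Term n → Term n
  ◇₃  : Term n → Term n

data Formula : ℕ → Set where
  _≐_  : ∀ {n} → Term n → Term n → Formula n
  _≺'_ : ∀ {n} → Term n → Term n → Formula n
  ¬'_  : ∀ {n} → Formula n → Formula n
  _∧'_ : ∀ {n} → Formula n → Formula n → Formula n
  _∨'_ : ∀ {n} → Formula n → Formula n → Formula n
  _⇒'_ : ∀ {n} → Formula n → Formula n → Formula n
  ∀'   : ∀ {n} → Formula (suc n) → Formula n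
  ∃'   : ∀ {n} → Formula (suc n) → Formula n

module _ (𝔐 : Structure) where
  open Structure 𝔐

  evalT : ∀ {n} → Vec D n → Term n → D
  evalT ρ (var i) = lookup ρ i
  evalT ρ (◇₁ t) = dia₁ (evalT ρ t)
  evalT ρ (◇₃ t) = dia₃ (evalT ρ t)

  -- classical (Gödel–Gentzen / double-negation) satisfaction
  Sat : ∀ {n} → Vec D n → Formula n → Set
  Sat ρ (t ≐ u)  = ¬ ¬ Eq (evalT ρ t) (evalT ρ u)
  Sat ρ (t ≺' u) = ¬ ¬ Lt (evalT ρ t) (evalT ρ u)
  Sat ρ (¬' φ)   = ¬ Sat ρ φ
  Sat ρ (φ ∧' ψ) = Sat ρ φ × Sat ρ ψ
  Sat ρ (φ ∨' ψ) = ¬ ((¬ Sat ρ φ) × (¬ Sat ρ ψ))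
  Sat ρ (φ ⇒' ψ) = Sat ρ φ → Sat ρ ψ
  Sat ρ (∀' φ)   = (d : D) → Sat (d ∷ ρ) φ
  Sat ρ (∃' φ)   = ¬ ((d : D) → ¬ Sat (d ∷ ρ) φ)

  Definable : (D → Set) → Set
  Definable P = Σ (Formula 1) λ φ →
    (d : D) → (P d → Sat (d ∷ Data.Vec.[]) φ) × (Sat (d ∷ Data.Vec.[]) φ → P d)

WStr : (α : Bound) → (Elem α → Elem α) → (Elem α → Elem α) → Structure
WStr α d₁ d₃ = record
  { D = Elem α
  ; Eq = λ A B → word A ≡ word B
  ; Lt = λ A B → word A ≺ word B
  ; dia₁ = d₁
  ; dia₃ = d₃
  }

-- W₃ is the initial segment of (W^N_α, ≺) below the one-letter word 4: a word over letters ≤ 3 lies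
-- strictly below 4, and a word with a letter ≥ 4 lies above it.  Moreover 4 is the least z ≻ Λ closed
-- under ◇₃ below z.  Any such z lies above every 3^k, because ◇₃ 3^k ∼ 3^(k+1), whereas a word over
-- letters ≤ 3 of length < k lies below 3^k; and below 4 one stays in W₃, which ◇₃ preserves.  Hence
-- x ∈ W₃ iff x ≺ z for every such z, a formula that does not even need ◇₁.
--
-- That ≾ is a total preorder holds only classically here (satisfaction is the double-negation
-- translation); it is proved by induction on the fuel of Leq, comparing lexicographically maximal
-- subsequences.

module Submission where

open import Defs
open import Data.List using ([_]; _++_)

open import Level using (0ℓ)
open import Data.Nat using (ℕ; zero; suc; _≤_; _<_; _⊓_; _≟_; z≤n; s≤s; _+_; _≤?_)
open import Data.Nat.Properties
open import Data.List using (List; []; _∷_; length; replicate)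
open import Data.List.Properties using (length-replicate)
open import Data.List.Relation.Unary.All as All using (All; []; _∷_)
open import Data.List.Relation.Unary.All.Properties using (++⁺; ++⁻ˡ; ++⁻ʳ; replicate⁺; ¬All⇒Any¬)
open import Data.List.Relation.Unary.Any as Any using (Any; here; there)
open import Data.List.Relation.Unary.Linked using (Linked; []; [-]; _∷_)
open import Data.List.Membership.Propositional using (find)
open import Data.List.Relation.Binary.Sublist.Propositional
  using (_⊆_; []; _∷_; _∷ʳ_; ⊆-refl; minimum; from∈; to∈)
open import Data.List.Relation.Binary.Sublist.Propositional.Properties using (All-resp-⊆)
open import Data.List.Relation.Binary.Sublist.Heterogeneous.Properties using (length-mono-≤)
open import Data.Product using (Σ; _×_; _,_; proj₁; proj₂)
open import Data.Sum as Sum using (_⊎_; inj₁; inj₂)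
open import Data.Unit using (tt)
open import Data.Empty using (⊥-elim)
open import Data.Fin using () renaming (zero to #0; suc to #suc)
open import Function using (id; _∘_; _⇔_; mk⇔; Equivalence)
open import Function.Construct.Symmetry using (⇔-sym)
open import Effect.Monad using (RawMonad)
open import Relation.Nullary using (¬_; yes; no; Dec)
open import Relation.Nullary.Negation using (¬¬-Monad; contradiction)
open import Relation.Nullary.Decidable using (¬¬-excluded-middle)
open import Relation.Binary.PropositionalEquality
  using (_≡_; _≢_; refl; sym; trans; cong; subst; subst₂)

open RawMonad (¬¬-Monad {0ℓ}) using (pure; _>>=_; _<$>_)

¬¬-pull-sublists : ∀ {A : Set} {P : List A → Set} (L : List A) →
                   (∀ S → S ⊆ L → ¬ ¬ P S) → ¬ ¬ (∀ S → S ⊆ L → P S)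
¬¬-pull-sublists [] h = do
  p ← h [] []
  pure λ { .[] [] → p }
¬¬-pull-sublists {P = P} (x ∷ L) h = do
  skip ← ¬¬-pull-sublists L (λ S S⊆L → h S (x ∷ʳ S⊆L))
  keep ← ¬¬-pull-sublists {P = P ∘ (x ∷_)} L (λ S S⊆L → h (x ∷ S) (refl ∷ S⊆L))
  pure λ { S (.x ∷ʳ S⊆L) → skip S S⊆L ; (.x ∷ S) (refl ∷ S⊆L) → keep S S⊆L }

⊆-singleton⇒head≡ : ∀ {A : Set} {x y : A} {xs} → x ∷ xs ⊆ [ y ] → x ≡ y
⊆-singleton⇒head≡ s with to∈ s
... | here x≡y = x≡y

All≤⊎Any> : ∀ c w → All (_≤ c) w ⊎ Any (c <_) w
All≤⊎Any> c w with All.all? (_≤? c) w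
... | yes w≤c = inj₁ w≤c
... | no  w≰c = inj₂ (Any.map ≰⇒> (¬All⇒Any¬ (_≤? c) w w≰c))

-- Splitting a word at a letter

module _ (n : ℕ) where

  split-All : ∀ {P : ℕ → Set} w → All P w → All (All (λ x → P x × x ≢ n)) (split n w)
  split-All {P} w pw = proj₁ (go w pw) ∷ proj₂ (go w pw)
    where
    go : ∀ w → All P w → All (λ x → P x × x ≢ n) (proj₁ (splitAux n w))
                         × All (All (λ x → P x × x ≢ n)) (proj₂ (splitAux n w))
    go [] [] = [] , []
    go (x ∷ w) (px ∷ pw) with x ≟ n | go w pw
    ... | yes _   | first , rest = [] , first ∷ rest
    ... | no  x≢n | first , rest = (px , x≢n) ∷ first , rest

  split-length : ∀ w → All (λ Y → length Y ≤ length w) (split n w)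
  split-length w = proj₁ (go w) ∷ proj₂ (go w)
    where
    go : ∀ w → length (proj₁ (splitAux n w)) ≤ length w
             × All (λ Y → length Y ≤ length w) (proj₂ (splitAux n w))
    go [] = z≤n , []
    go (x ∷ w) with x ≟ n | go w
    ... | yes _ | first , rest = z≤n , m≤n⇒m≤1+n first ∷ All.map m≤n⇒m≤1+n rest
    ... | no  _ | first , rest = s≤s first , All.map m≤n⇒m≤1+n rest

  splitAux-avoiding : ∀ w → All (_≢ n) w → splitAux n w ≡ (w , [])
  splitAux-avoiding [] [] = refl
  splitAux-avoiding (x ∷ w) (x≢n ∷ w≢n) with x ≟ n
  ... | yes x≡n = contradiction x≡n x≢n
  ... | no  _   rewrite splitAux-avoiding w w≢n = refl

  split-avoiding : ∀ w → All (_≢ n) w → split n w ≡ [ w ]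
  split-avoiding w w≢n rewrite splitAux-avoiding w w≢n = refl

  splitAux-constant : ∀ w → All (_≡ n) w → splitAux n w ≡ ([] , replicate (length w) [])
  splitAux-constant [] [] = refl
  splitAux-constant (x ∷ w) (x≡n ∷ w≡n) with x ≟ n
  ... | yes _   rewrite splitAux-constant w w≡n = refl
  ... | no  x≢n = contradiction x≡n x≢n

  split-constant : ∀ w → All (_≡ n) w → split n w ≡ replicate (suc (length w)) []
  split-constant w w≡n rewrite splitAux-constant w w≡n = refl

  split-Any : ∀ {Q : ℕ → Set} w → Any Q w → (∀ {x} → Q x → x ≢ n) → Any (Any Q) (split n w)
  split-Any {Q} w q Q≢n = Sum.[ here , there ]′ (go w q)
    where
    go : ∀ w → Any Q w → Any Q (proj₁ (splitAux n w)) ⊎ Any (Any Q) (proj₂ (splitAux n w))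
    go (x ∷ w) (here qx) with x ≟ n
    ... | yes x≡n = contradiction x≡n (Q≢n qx)
    ... | no  _   = inj₁ (here qx)
    go (x ∷ w) (there q) with x ≟ n | go w q
    ... | yes _ | inj₁ first = inj₂ (here first)
    ... | yes _ | inj₂ rest  = inj₂ (there rest)
    ... | no  _ | inj₁ first = inj₁ (there first)
    ... | no  _ | inj₂ rest  = inj₂ rest

minW-≤ : ∀ x xs → All (minW x xs ≤_) (x ∷ xs)
minW-≤ x [] = ≤-refl ∷ []
minW-≤ x (y ∷ ys) with minW-≤ x ys
... | x≥m ∷ ys≥m = ≤-trans (m⊓n≤n y _) x≥m ∷ m⊓n≤m y _ ∷ All.map (≤-trans (m⊓n≤n y _)) ys≥m

minW-closed : ∀ {P : ℕ → Set} x xs → P x → All P xs → P (minW x xs)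
minW-closed x [] px [] = px
minW-closed {P} x (y ∷ ys) px (py ∷ pys) with ⊓-sel y (minW x ys)
... | inj₁ eq = subst P (sym eq) py
... | inj₂ eq = subst P (sym eq) (minW-closed x ys px pys)

All-≤-maxW : ∀ w → All (_≤ maxW w) w
All-≤-maxW [] = []
All-≤-maxW (x ∷ xs) = m≤m⊔n x _ ∷ All.map (λ h → ≤-trans h (m≤n⊔m x _)) (All-≤-maxW xs)

-- Every letter of w lies in [n, n + f).  Leq f A B is the paper's A ≾ B as long as A and B lie in a common band of width f.
Band : ℕ → ℕ → Word → Set
Band n f = All (λ x → n ≤ x × x < n + f)

Band-zero : ∀ {n x xs} → ¬ Band n 0 (x ∷ xs)
Band-zero {n} ((n≤x , x<n+0) ∷ _) = <-irrefl refl (≤-<-trans n≤x (subst (_ <_) (+-identityʳ n) x<n+0))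

Band-zero-[] : ∀ {n w} → Band n 0 w → w ≡ []
Band-zero-[] [] = refl
Band-zero-[] b@(_ ∷ _) = contradiction b Band-zero

Band-⊓ : ∀ {n f g w} → Band n f w → Band n g w → Band n (f ⊓ g) w
Band-⊓ {n} {f} {g} bf bg = All.zipWith
  (λ ((n≤x , x<f) , (_ , x<g)) → n≤x , subst (_ <_) (sym (+-distribˡ-⊓ n f g)) (⊓-glb x<f x<g)) (bf , bg)

Band-widen : ∀ {n f} w → Band n f w → Band n (suc f) w
Band-widen {n} {f} w = All.map λ (n≤x , x<) → n≤x , <-≤-trans x< (+-monoʳ-≤ n (n≤1+n f))

Band-raise : ∀ {n m f} w → Band n f w → All (m ≤_) w → n ≤ m → Band m f w
Band-raise {f = f} w b m≤w n≤m =
  All.zipWith (λ ((_ , x<) , m≤x) → m≤x , <-≤-trans x< (+-monoˡ-≤ f n≤m)) (b , m≤w)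

Band-shrink : ∀ {n f} w → Band n (suc f) w → All (_≢ n) w → Band (suc n) f w
Band-shrink {n} {f} w b w≢n = All.zipWith
  (λ {x} ((n≤x , x<) , x≢n) → ≤∧≢⇒< n≤x (x≢n ∘ sym) , subst (x <_) (+-suc n f) x<) (b , w≢n)

split-Band : ∀ {n f} w → Band n (suc f) w → All (Band (suc n) f) (split n w)
split-Band {n} w b =
  All.map (λ {Y} Y∈band → Band-shrink Y (All.map proj₁ Y∈band) (All.map proj₂ Y∈band)) (split-All n w b)

All≤⇒Band : ∀ M w → All (_≤ M) w → Band 0 (suc M) w
All≤⇒Band M w = All.map λ x≤M → z≤n , s≤s x≤M

Band-min : ∀ {n f x xs} A B → A ++ B ≡ x ∷ xs → Band n f A → Band n f B →
           n ≤ minW x xs × Band (minW x xs) f A × Band (minW x xs) f B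
Band-min {n} {x = x} {xs} A B eq bA bB =
  n≤m , Band-raise A bA (++⁻ˡ A m≤AB) n≤m , Band-raise B bB (++⁻ʳ A m≤AB) n≤m
  where
  bAB = subst (Band n _) eq (++⁺ bA bB)
  n≤m = minW-closed x xs (proj₁ (All.head bAB)) (All.map proj₁ (All.tail bAB))
  m≤AB = subst (All (minW x xs ≤_)) (sym eq) (minW-≤ x xs)

Dominates : ℕ → List Word → List Word → Set
Dominates f C L = ∀ S → S ⊆ L → LexLeq f S C

-- Leq (suc f) A B unfolds to LexMaxLeq f (split n A) (split n B) at the least letter n of A B;
-- C and D are the paper's lexicographically maximal subsequences.
LexMaxLeq : ℕ → List Word → List Word → Set
LexMaxLeq f L M = Σ (List Word) λ C → Σ (List Word) λ D →
  C ⊆ L × D ⊆ M × Dominates f C L × Dominates f D M × LexLeq f C D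

Leq-suc : ∀ f A B {x xs} → A ++ B ≡ x ∷ xs →
          Leq (suc f) A B ≡ LexMaxLeq f (split (minW x xs) A) (split (minW x xs) B)
Leq-suc f (a ∷ A) B  refl = refl
Leq-suc f [] (b ∷ B) refl = refl

Leq-[][] : ∀ f → Leq f [] []
Leq-[][] zero    = tt
Leq-[][] (suc f) = tt

LexMaxLeq-map : ∀ {f g} {Q : Word → Set} {L M} → All Q L → All Q M →
                (∀ {S T} → All Q S → All Q T → LexLeq f S T → LexLeq g S T) →
                LexMaxLeq f L M → LexMaxLeq g L M
LexMaxLeq-map qL qM h (C , D , C⊆L , D⊆M , C-max , D-max , C≤D) =
  C , D , C⊆L , D⊆M ,
  (λ S S⊆L → h (All-resp-⊆ S⊆L qL) qC (C-max S S⊆L)) ,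
  (λ S S⊆M → h (All-resp-⊆ S⊆M qM) qD (D-max S S⊆M)) ,
  h qC qD C≤D
  where
  qC = All-resp-⊆ C⊆L qL
  qD = All-resp-⊆ D⊆M qM

LexLeq-∷-⇔ : ∀ {f g x y xs ys} → Leq f x y ⇔ Leq g x y → Leq f y x ⇔ Leq g y x →
             LexLeq f xs ys ⇔ LexLeq g xs ys → LexLeq f (x ∷ xs) (y ∷ ys) ⇔ LexLeq g (x ∷ xs) (y ∷ ys)
LexLeq-∷-⇔ xy yx rest = mk⇔ (move xy yx rest) (move (⇔-sym xy) (⇔-sym yx) (⇔-sym rest))
  where
  open Equivalence using (to; from)
  move : ∀ {P P′ Q Q′ R R′ : Set} → P ⇔ P′ → Q ⇔ Q′ → R ⇔ R′ → (P × Q × R) ⊎ (P × ¬ Q) → (P′ × Q′ × R′) ⊎ (P′ × ¬ Q′)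
  move p q r = Sum.map (λ (a , b , c) → to p a , to q b , to r c) (λ (a , ¬b) → to p a , ¬b ∘ from q)

mutual
  Leq-fuel : ∀ f g {n} A B → Band n (f ⊓ g) A → Band n (f ⊓ g) B → Leq f A B ⇔ Leq g A B
  Leq-fuel zero    zero    A B _  _  = mk⇔ id id
  Leq-fuel zero    (suc g) A B bA bB rewrite Band-zero-[] bA | Band-zero-[] bB = mk⇔ _ _
  Leq-fuel (suc f) zero    A B bA bB rewrite Band-zero-[] bA | Band-zero-[] bB = mk⇔ _ _
  Leq-fuel (suc f) (suc g) [] [] _ _ = mk⇔ _ _
  Leq-fuel (suc f) (suc g) (a ∷ A) B bA bB = Leq-fuel-nonempty f g (a ∷ A) B refl bA bB
  Leq-fuel (suc f) (suc g) [] (b ∷ B) bA bB = Leq-fuel-nonempty f g [] (b ∷ B) refl bA bB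

  Leq-fuel-nonempty : ∀ f g {n x xs} A B → A ++ B ≡ x ∷ xs →
                      Band n (suc (f ⊓ g)) A → Band n (suc (f ⊓ g)) B → Leq (suc f) A B ⇔ Leq (suc g) A B
  Leq-fuel-nonempty f g A B eq bA bB
    rewrite Leq-suc f A B eq | Leq-suc g A B eq
    with _ , mA , mB ← Band-min A B eq bA bB =
    mk⇔ (LexMaxLeq-map qA qB λ qS qT → Equivalence.to   (LexLeq-fuel f g _ _ qS qT))
        (LexMaxLeq-map qA qB λ qS qT → Equivalence.from (LexLeq-fuel f g _ _ qS qT))
    where
    qA = split-Band A mA
    qB = split-Band B mB

  LexLeq-fuel : ∀ f g {n} xs ys → All (Band n (f ⊓ g)) xs → All (Band n (f ⊓ g)) ys →
                LexLeq f xs ys ⇔ LexLeq g xs ys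
  LexLeq-fuel f g []       ys       _          _          = mk⇔ _ _
  LexLeq-fuel f g (x ∷ xs) []       _          _          = mk⇔ id id
  LexLeq-fuel f g (x ∷ xs) (y ∷ ys) (bx ∷ bxs) (by ∷ bys) =
    LexLeq-∷-⇔ (Leq-fuel f g x y bx by) (Leq-fuel f g y x by bx) (LexLeq-fuel f g xs ys bxs bys)

Leq-suc-above : ∀ {f n} A B → Band n (suc f) A → Band n (suc f) B → All (_≢ n) A → All (_≢ n) B →
                Leq (suc f) A B ⇔ Leq f A B
Leq-suc-above {f} A B bA bB A≢n B≢n = Leq-fuel (suc f) f A B (narrow A bA A≢n) (narrow B bB B≢n)
  where
  narrow : ∀ w → Band _ (suc f) w → All (_≢ _) w → Band _ (suc f ⊓ f) w
  narrow w b w≢n = Band-⊓ (Band-widen w (Band-shrink w b w≢n)) (Band-shrink w b w≢n)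

≢-below : ∀ {n m x} → n < m → m ≤ x → x ≢ n
≢-below n<m m≤x x≡n = <-irrefl (sym x≡n) (<-≤-trans n<m m≤x)

All-≢-below : ∀ {n m} w → n < m → All (m ≤_) w → All (_≢ n) w
All-≢-below w n<m = All.map (≢-below n<m)

LexLeq-head : ∀ {f x y xs ys} → LexLeq f (x ∷ xs) (y ∷ ys) → Leq f x y
LexLeq-head = Sum.[ proj₁ , proj₁ ]′

LexLeq-singleton : ∀ {f A d D} → Leq f A d → Dec (Leq f d A) → LexLeq f [ A ] (d ∷ D)
LexLeq-singleton A≤d (yes d≤A) = inj₁ (A≤d , d≤A , tt)
LexLeq-singleton A≤d (no  d≰A) = inj₂ (A≤d , d≰A)

singleton-Dominates : ∀ {f A} → Leq f A A → Dominates f [ A ] [ A ]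
singleton-Dominates A≤A .[]      (_ ∷ʳ [])    = tt
singleton-Dominates A≤A (_ ∷ .[]) (refl ∷ []) = inj₁ (A≤A , A≤A , tt)

LexMaxLeq-singletons : ∀ {f} A B → LexMaxLeq f [ A ] [ B ] → Leq f A B
LexMaxLeq-singletons A B ([] , _ , _ , _ , C-max , _ , _) = ⊥-elim (C-max [ A ] ⊆-refl)
LexMaxLeq-singletons A B (_ ∷ _ , [] , _ , _ , _ , _ , ())
LexMaxLeq-singletons A B (_ ∷ _ , _ ∷ _ , C⊆ , D⊆ , _ , _ , C≤D)
  with refl ← ⊆-singleton⇒head≡ C⊆ | refl ← ⊆-singleton⇒head≡ D⊆ = LexLeq-head C≤D

Leq-suc-unfolds-or-avoids-nonempty : ∀ {f n x xs} A B → A ++ B ≡ x ∷ xs → Band n (suc f) A → Band n (suc f) B →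
  (Leq (suc f) A B ≡ LexMaxLeq f (split n A) (split n B)) ⊎ (All (_≢ n) A × All (_≢ n) B)
Leq-suc-unfolds-or-avoids-nonempty {f} {n} {x} {xs} A B eq bA bB with n ≟ minW x xs | Band-min A B eq bA bB
... | yes refl | _ = inj₁ (Leq-suc f A B eq)
... | no n≢m | n≤m , mA , mB =
  inj₂ (All-≢-below A n<m (All.map proj₁ mA) , All-≢-below B n<m (All.map proj₁ mB))
  where n<m = ≤∧≢⇒< n≤m n≢m

Leq-suc-unfolds-or-avoids : ∀ {f n} A B → Band n (suc f) A → Band n (suc f) B →
  (Leq (suc f) A B ≡ LexMaxLeq f (split n A) (split n B)) ⊎ (All (_≢ n) A × All (_≢ n) B)
Leq-suc-unfolds-or-avoids []      []      _  _  = inj₂ ([] , [])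
Leq-suc-unfolds-or-avoids (a ∷ A) B       bA bB = Leq-suc-unfolds-or-avoids-nonempty (a ∷ A) B refl bA bB
Leq-suc-unfolds-or-avoids []      (b ∷ B) bA bB = Leq-suc-unfolds-or-avoids-nonempty [] (b ∷ B) refl bA bB

Leq-fold : ∀ {f n} A B → Band n (suc f) A → Band n (suc f) B →
           LexMaxLeq f (split n A) (split n B) → Leq (suc f) A B
Leq-fold {f} {n} A B bA bB body with Leq-suc-unfolds-or-avoids A B bA bB
... | inj₁ eq = subst id (sym eq) body
... | inj₂ (A≢n , B≢n) = Equivalence.from (Leq-suc-above A B bA bB A≢n B≢n)
  (LexMaxLeq-singletons A B (subst₂ (LexMaxLeq f) (split-avoiding n A A≢n) (split-avoiding n B B≢n) body))

record ClassicalTotalPreorder (f : ℕ) : Set where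
  field
    Leq-refl  : ∀ {n} A → Band n f A → ¬ ¬ Leq f A A
    Leq-trans : ∀ {n} A B C → Band n f A → Band n f B → Band n f C →
                Leq f A B → Leq f B C → ¬ ¬ Leq f A C
    Leq-total : ∀ {n} A B → Band n f A → Band n f B → ¬ ¬ (Leq f A B ⊎ Leq f B A)

module Lexicographic {f} (P : ClassicalTotalPreorder f) (n : ℕ) where
  open ClassicalTotalPreorder P

  Banded : List Word → Set
  Banded = All (Band n f)

  LexLeq-∷ : ∀ {x S C} → Band n f x → LexLeq f S C → ¬ ¬ LexLeq f (x ∷ S) (x ∷ C)
  LexLeq-∷ {x} bx S≤C = do
    x≤x ← Leq-refl x bx
    pure (inj₁ (x≤x , x≤x , S≤C))

  LexLeq-refl : ∀ xs → Banded xs → ¬ ¬ LexLeq f xs xs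
  LexLeq-refl []       _          = pure tt
  LexLeq-refl (x ∷ xs) (bx ∷ bxs) = LexLeq-refl xs bxs >>= LexLeq-∷ bx

  LexLeq-trans : ∀ xs ys zs → Banded xs → Banded ys → Banded zs →
                 LexLeq f xs ys → LexLeq f ys zs → ¬ ¬ LexLeq f xs zs
  LexLeq-trans [] _ _ _ _ _ _ _ = pure tt
  LexLeq-trans (x ∷ xs) (y ∷ ys) (z ∷ zs) (bx ∷ bxs) (by ∷ bys) (bz ∷ bzs)
               (inj₁ (x≤y , y≤x , xs≤ys)) (inj₁ (y≤z , z≤y , ys≤zs)) = do
    x≤z ← Leq-trans x y z bx by bz x≤y y≤z
    z≤x ← Leq-trans z y x bz by bx z≤y y≤x
    xs≤zs ← LexLeq-trans xs ys zs bxs bys bzs xs≤ys ys≤zs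
    pure (inj₁ (x≤z , z≤x , xs≤zs))
  LexLeq-trans (x ∷ _) (y ∷ _) (z ∷ _) (bx ∷ _) (by ∷ _) (bz ∷ _)
               (inj₁ (x≤y , _ , _)) (inj₂ (y≤z , z≰y)) = do
    x≤z ← Leq-trans x y z bx by bz x≤y y≤z
    pure (inj₂ (x≤z , λ z≤x → Leq-trans z x y bz bx by z≤x x≤y z≰y))
  LexLeq-trans (x ∷ _) (y ∷ _) (z ∷ zs) (bx ∷ _) (by ∷ _) (bz ∷ _)
               (inj₂ (x≤y , y≰x)) y∷ys≤z∷zs = do
    x≤z ← Leq-trans x y z bx by bz x≤y y≤z
    pure (inj₂ (x≤z , λ z≤x → Leq-trans y z x by bz bx y≤z z≤x y≰x))
    where y≤z = LexLeq-head {f} {ys = zs} y∷ys≤z∷zs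

  LexLeq-total : ∀ xs ys → Banded xs → Banded ys → ¬ ¬ (LexLeq f xs ys ⊎ LexLeq f ys xs)
  LexLeq-total []       _        _          _          = pure (inj₁ tt)
  LexLeq-total (x ∷ xs) []       _          _          = pure (inj₂ tt)
  LexLeq-total (x ∷ xs) (y ∷ ys) (bx ∷ bxs) (by ∷ bys) = do
    x≤y? ← ¬¬-excluded-middle
    y≤x? ← ¬¬-excluded-middle
    compare x≤y? y≤x?
    where
    compare : Dec (Leq f x y) → Dec (Leq f y x) → ¬ ¬ (LexLeq f (x ∷ xs) (y ∷ ys) ⊎ LexLeq f (y ∷ ys) (x ∷ xs))
    compare (yes x≤y) (yes y≤x) =
      Sum.map (λ l → inj₁ (x≤y , y≤x , l)) (λ l → inj₁ (y≤x , x≤y , l)) <$> LexLeq-total xs ys bxs bys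
    compare (yes x≤y) (no y≰x) = pure (inj₁ (inj₂ (x≤y , y≰x)))
    compare (no x≰y)  (yes y≤x) = pure (inj₂ (inj₂ (y≤x , x≰y)))
    compare (no x≰y)  (no y≰x) = λ _ → Leq-total x y bx by Sum.[ x≰y , y≰x ]′

  -- The lexicographic maximum of the sublists of x ∷ xs is that of xs, possibly with x put in front.
  maxSublist : ∀ L → Banded L → ¬ ¬ Σ (List Word) λ C → C ⊆ L × Dominates f C L
  maxSublist []       _          = pure ([] , [] , λ { .[] [] → tt })
  maxSublist (x ∷ xs) (bx ∷ bxs) = do
    C , C⊆xs , C-max ← maxSublist xs bxs
    x∷C≤C? ← ¬¬-excluded-middle
    extend C C⊆xs C-max x∷C≤C?
    where
    extend : ∀ C → C ⊆ xs → Dominates f C xs → Dec (LexLeq f (x ∷ C) C) →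
             ¬ ¬ Σ (List Word) λ C → C ⊆ x ∷ xs × Dominates f C (x ∷ xs)
    extend C C⊆xs C-max (yes x∷C≤C) = do
      C-max′ ← ¬¬-pull-sublists (x ∷ xs) dominated
      pure (C , x ∷ʳ C⊆xs , C-max′)
      where
      bC = All-resp-⊆ C⊆xs bxs
      dominated : ∀ S → S ⊆ x ∷ xs → ¬ ¬ LexLeq f S C
      dominated S       (.x ∷ʳ S⊆xs)  = pure (C-max S S⊆xs)
      dominated (.x ∷ S) (refl ∷ S⊆xs) = do
        x∷S≤x∷C ← LexLeq-∷ bx (C-max S S⊆xs)
        LexLeq-trans (x ∷ S) (x ∷ C) C (bx ∷ All-resp-⊆ S⊆xs bxs) (bx ∷ bC) bC x∷S≤x∷C x∷C≤C
    extend C C⊆xs C-max (no x∷C≰C) = do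
      inj₂ C≤x∷C ← LexLeq-total (x ∷ C) C (bx ∷ bC) bC
        where inj₁ x∷C≤C → contradiction x∷C≤C x∷C≰C
      C-max′ ← ¬¬-pull-sublists (x ∷ xs) (dominated C≤x∷C)
      pure (x ∷ C , refl ∷ C⊆xs , C-max′)
      where
      bC = All-resp-⊆ C⊆xs bxs
      dominated : LexLeq f C (x ∷ C) → ∀ S → S ⊆ x ∷ xs → ¬ ¬ LexLeq f S (x ∷ C)
      dominated C≤x∷C S       (.x ∷ʳ S⊆xs)  =
        LexLeq-trans S C (x ∷ C) (All-resp-⊆ S⊆xs bxs) bC (bx ∷ bC) (C-max S S⊆xs) C≤x∷C
      dominated C≤x∷C (.x ∷ S) (refl ∷ S⊆xs) = LexLeq-∷ bx (C-max S S⊆xs)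

module Unfolding {f} (P : ClassicalTotalPreorder f) where
  open ClassicalTotalPreorder P

  singletons-LexMaxLeq : ∀ {n} A B → Band n f A → Band n f B → Leq f A B → ¬ ¬ LexMaxLeq f [ A ] [ B ]
  singletons-LexMaxLeq A B bA bB A≤B = do
    A≤A ← Leq-refl A bA
    B≤B ← Leq-refl B bB
    B≤A? ← ¬¬-excluded-middle
    pure ([ A ] , [ B ] , ⊆-refl , ⊆-refl , singleton-Dominates A≤A , singleton-Dominates B≤B ,
          LexLeq-singleton {f} {A} {B} {[]} A≤B B≤A?)

  Leq-unfold : ∀ {n} A B → Band n (suc f) A → Band n (suc f) B →
               Leq (suc f) A B → ¬ ¬ LexMaxLeq f (split n A) (split n B)
  Leq-unfold {n} A B bA bB A≤B with Leq-suc-unfolds-or-avoids A B bA bB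
  ... | inj₁ eq = pure (subst id eq A≤B)
  ... | inj₂ (A≢n , B≢n) =
    subst₂ (LexMaxLeq f) (sym (split-avoiding n A A≢n)) (sym (split-avoiding n B B≢n)) <$>
    singletons-LexMaxLeq A B (Band-shrink A bA A≢n) (Band-shrink B bB B≢n)
      (Equivalence.to (Leq-suc-above A B bA bB A≢n B≢n) A≤B)

Leq-classical : ∀ f → ClassicalTotalPreorder f
Leq-classical zero = record
  { Leq-refl  = λ _ _ → pure tt
  ; Leq-trans = λ _ _ _ _ _ _ _ _ → pure tt
  ; Leq-total = λ _ _ _ _ → pure (inj₁ tt)
  }
Leq-classical (suc f) = record { Leq-refl = refl′ ; Leq-trans = trans′ ; Leq-total = total′ }
  where
  P = Leq-classical f
  open Unfolding P
  open module Lex {n} = Lexicographic P (suc n)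

  refl′ : ∀ {n} A → Band n (suc f) A → ¬ ¬ Leq (suc f) A A
  refl′ {n} A bA = do
    C , C⊆ , C-max ← maxSublist (split n A) (split-Band A bA)
    C≤C ← LexLeq-refl C (All-resp-⊆ C⊆ (split-Band A bA))
    pure (Leq-fold A A bA bA (C , C , C⊆ , C⊆ , C-max , C-max , C≤C))

  trans′ : ∀ {n} A B C → Band n (suc f) A → Band n (suc f) B → Band n (suc f) C →
           Leq (suc f) A B → Leq (suc f) B C → ¬ ¬ Leq (suc f) A C
  trans′ A B C bA bB bC A≤B B≤C = do
    X₁ , Y₁ , X₁⊆ , Y₁⊆ , X₁-max , _ , X₁≤Y₁ ← Leq-unfold A B bA bB A≤B
    Y₂ , Z₂ , Y₂⊆ , Z₂⊆ , Y₂-max , Z₂-max , Y₂≤Z₂ ← Leq-unfold B C bB bC B≤C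
    X₁≤Y₂ ← LexLeq-trans X₁ Y₁ Y₂ (band X₁⊆ bA) (band Y₁⊆ bB) (band Y₂⊆ bB) X₁≤Y₁ (Y₂-max Y₁ Y₁⊆)
    X₁≤Z₂ ← LexLeq-trans X₁ Y₂ Z₂ (band X₁⊆ bA) (band Y₂⊆ bB) (band Z₂⊆ bC) X₁≤Y₂ Y₂≤Z₂
    pure (Leq-fold A C bA bC (X₁ , Z₂ , X₁⊆ , Z₂⊆ , X₁-max , Z₂-max , X₁≤Z₂))
    where
    band : ∀ {n S W} → S ⊆ split n W → Band n (suc f) W → All (Band (suc n) f) S
    band {W = W} S⊆ bW = All-resp-⊆ S⊆ (split-Band W bW)

  total′ : ∀ {n} A B → Band n (suc f) A → Band n (suc f) B → ¬ ¬ (Leq (suc f) A B ⊎ Leq (suc f) B A)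
  total′ {n} A B bA bB = do
    C , C⊆ , C-max ← maxSublist (split n A) (split-Band A bA)
    D , D⊆ , D-max ← maxSublist (split n B) (split-Band B bB)
    Sum.map (λ C≤D → Leq-fold A B bA bB (C , D , C⊆ , D⊆ , C-max , D-max , C≤D))
            (λ D≤C → Leq-fold B A bB bA (D , C , D⊆ , C⊆ , D-max , C-max , D≤C)) <$>
      LexLeq-total C D (All-resp-⊆ C⊆ (split-Band A bA)) (All-resp-⊆ D⊆ (split-Band B bB))

Leq-[]ˡ : ∀ f {n} X → Band n f X → ¬ ¬ Leq f [] X
Leq-[]ˡ zero    X _ = pure tt
Leq-[]ˡ (suc f) {n} X bX = do
  D , D⊆ , D-max ← maxSublist (split n X) bPieces
  []≤D ← []≤ D D⊆ (D-max [ proj₁ (splitAux n X) ] (refl ∷ minimum _))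
  pure (Leq-fold [] X [] bX ([ [] ] , D , ⊆-refl , D⊆ , singleton-Dominates (Leq-[][] f) , D-max , []≤D))
  where
  open Lexicographic (Leq-classical f) (suc n)
  bPieces = split-Band X bX
  []≤ : ∀ D → D ⊆ split n X → LexLeq f [ proj₁ (splitAux n X) ] D → ¬ ¬ LexLeq f [ [] ] D
  []≤ (d ∷ D) D⊆ _ = do
    []≤d ← Leq-[]ˡ f d (All.head (All-resp-⊆ D⊆ bPieces))
    d≤[]? ← ¬¬-excluded-middle
    pure (LexLeq-singleton {f} {[]} {d} {D} []≤d d≤[]?)

⊆[[]]-LexLeq-singleton : ∀ {f Y D} → D ⊆ [ [] ] → LexLeq f [ Y ] D → Leq f Y []
⊆[[]]-LexLeq-singleton {f} {Y} (refl ∷ []) = LexLeq-head {f} {Y} {[]} {[]} {[]}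

⊆[[]]-¬LexLeq-pair : ∀ {f Y D} → D ⊆ [ [] ] → ¬ LexLeq f ([] ∷ Y ∷ []) D
⊆[[]]-¬LexLeq-pair {f} (refl ∷ []) (inj₂ (_ , []≰[])) = []≰[] (Leq-[][] f)

Leq-∷-[] : ∀ f {n x xs} → Band n f (x ∷ xs) → ¬ Leq f (x ∷ xs) []
Leq-∷-[] zero    b _ = Band-zero b
Leq-∷-[] (suc f) {n} {x} {xs} b x∷xs≤[] =
  Leq-unfold (x ∷ xs) [] b [] x∷xs≤[] (impossible (split-Band (x ∷ xs) b))
  where
  open Unfolding (Leq-classical f)
  open Lexicographic (Leq-classical f) (suc n)
  impossible : All (Band (suc n) f) (split n (x ∷ xs)) → ¬ LexMaxLeq f (split n (x ∷ xs)) [ [] ]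
  impossible bPieces (C , D , C⊆ , D⊆ , C-max , _ , C≤D) with x ≟ n
  ... | yes _ = LexLeq-trans S C D (All-resp-⊆ S⊆ bPieces) (All-resp-⊆ C⊆ bPieces) (All-resp-⊆ D⊆ ([] ∷ []))
                  (C-max S S⊆) C≤D (⊆[[]]-¬LexLeq-pair D⊆)
    where
    S = [] ∷ proj₁ (splitAux n xs) ∷ []
    S⊆ = refl ∷ refl ∷ minimum _
  ... | no _ = LexLeq-trans S C D (All-resp-⊆ S⊆ bPieces) (All-resp-⊆ C⊆ bPieces) (All-resp-⊆ D⊆ ([] ∷ []))
                 (C-max S S⊆) C≤D (Leq-∷-[] f (All.head bPieces) ∘ ⊆[[]]-LexLeq-singleton D⊆)
    where
    S = [ x ∷ proj₁ (splitAux n xs) ]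
    S⊆ = refl ∷ minimum _

module _ {f : ℕ} where

  LexLeq-empties⇒≤ : ∀ xs ys → All (_≡ []) xs → All (_≡ []) ys → LexLeq f xs ys → length xs ≤ length ys
  LexLeq-empties⇒≤ []       _        _           _           _ = z≤n
  LexLeq-empties⇒≤ (_ ∷ xs) (_ ∷ ys) (refl ∷ xs≡) (refl ∷ ys≡) (inj₁ (_ , _ , xs≤ys)) =
    s≤s (LexLeq-empties⇒≤ xs ys xs≡ ys≡ xs≤ys)
  LexLeq-empties⇒≤ (_ ∷ xs) (_ ∷ ys) (refl ∷ _)   (refl ∷ _)   (inj₂ (_ , []≰[])) = ⊥-elim ([]≰[] (Leq-[][] f))

  ≤⇒LexLeq-empties : ∀ xs ys → All (_≡ []) xs → All (_≡ []) ys → length xs ≤ length ys → LexLeq f xs ys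
  ≤⇒LexLeq-empties []       _        _           _           _       = tt
  ≤⇒LexLeq-empties (_ ∷ xs) (_ ∷ ys) (refl ∷ xs≡) (refl ∷ ys≡) (s≤s ≤) =
    inj₁ (Leq-[][] f , Leq-[][] f , ≤⇒LexLeq-empties xs ys xs≡ ys≡ ≤)

  ¬LexMaxLeq-empties : ∀ K J → J < K → ¬ LexMaxLeq f (replicate K []) (replicate J [])
  ¬LexMaxLeq-empties K J J<K (C , D , C⊆ , D⊆ , C-max , _ , C≤D) = <⇒≱ J<K (begin
    K                       ≡⟨ length-replicate K ⟨
    length (replicate K []) ≤⟨ LexLeq-empties⇒≤ _ C (empties K) C≡ (C-max _ ⊆-refl) ⟩
    length C                ≤⟨ LexLeq-empties⇒≤ C D C≡ D≡ C≤D ⟩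
    length D                ≤⟨ length-mono-≤ D⊆ ⟩
    length (replicate J []) ≡⟨ length-replicate J ⟩
    J                       ∎)
    where
    open ≤-Reasoning
    empties : ∀ k → All (_≡ []) (replicate {A = Word} k [])
    empties k = replicate⁺ k refl
    C≡ = All-resp-⊆ C⊆ (empties K)
    D≡ = All-resp-⊆ D⊆ (empties J)

split-replicate : ∀ c k → split c (replicate k c) ≡ replicate (suc k) []
split-replicate c k = trans (split-constant c (replicate k c) (replicate⁺ k refl))
                            (cong (λ l → replicate (suc l) []) (length-replicate k))

Band-squeeze : ∀ {c f} w → All (_≤ c) w → Band c f w → All (_≡ c) w
Band-squeeze w w≤c bw = All.zipWith (λ (x≤c , c≤x , _) → ≤-antisym x≤c c≤x) (w≤c , bw)

All<-All≡⇒[] : ∀ {c} w → All (_< c) w → All (_≡ c) w → w ≡ []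
All<-All≡⇒[] []      _          _          = refl
All<-All≡⇒[] (x ∷ _) (x<c ∷ _) (refl ∷ _) = ⊥-elim (<-irrefl refl x<c)

¬Leq-replicate : ∀ f {n} c k w → n ≤ c → 0 < k → All (_≤ c) w → length w < k ⊎ All (_< c) w →
                 Band n f (replicate k c) → Band n f w → ¬ Leq f (replicate k c) w
¬Leq-replicate zero    c (suc k) w _ _ _ _ bC _ _ = Band-zero bC
¬Leq-replicate (suc f) {n} c k w n≤c 0<k w≤c short bC bw cᵏ≤w =
  Leq-unfold (replicate k c) w bC bw cᵏ≤w impossible
  where
  open Unfolding (Leq-classical f)
  impossible : ¬ LexMaxLeq f (split n (replicate k c)) (split n w)
  impossible body with n ≟ c
  ... | yes refl = ¬LexMaxLeq-empties (suc k) (suc (length w)) (s≤s |w|<k)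
                     (subst₂ (LexMaxLeq f) (split-replicate n k) (split-constant n w w≡n) body)
    where
    w≡n = Band-squeeze w w≤c bw
    |w|<k = Sum.[ id , (λ w<n → subst (λ v → length v < k) (sym (All<-All≡⇒[] w w<n w≡n)) 0<k) ]′ short
  ... | no n≢c = below (subst (λ L → LexMaxLeq f L (split n w)) (split-avoiding n _ cᵏ≢n) body)
    where
    cᵏ≢n = replicate⁺ k (n≢c ∘ sym)
    below : ¬ LexMaxLeq f [ replicate k c ] (split n w)
    below ([] , _ , _ , _ , C-max , _ , _) = C-max _ ⊆-refl
    below (_ ∷ _ , d ∷ _ , C⊆ , D⊆ , _ , _ , C≤D) with refl ← ⊆-singleton⇒head≡ C⊆ =
      ¬Leq-replicate f c k d (≤∧≢⇒< n≤c n≢c) 0<k d≤c d-short (Band-shrink _ bC cᵏ≢n) bd (LexLeq-head C≤D)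
      where
      piece : ∀ {P : Word → Set} → All P (split n w) → P d
      piece = All.head ∘ All-resp-⊆ D⊆
      bd = piece (split-Band w bw)
      d≤c = All.map proj₁ (piece (split-All n w w≤c))
      d-short = Sum.map (λ |w|<k → ≤-<-trans (piece (split-length n w)) |w|<k)
                        (λ w<c → All.map proj₁ (piece (split-All n w w<c))) short

Any-¬Leq-[] : ∀ f {n} {P : ℕ → Set} Y → Any P Y → Band n f Y → ¬ Leq f Y []
Any-¬Leq-[] f (_ ∷ _) _ = Leq-∷-[] f

singleton-Leq-bottom : ∀ f c y → Any (c ≤_) y → Band c (suc f) [ c ] → Band c (suc f) y →
                       ¬ ¬ Leq (suc f) [ c ] y
singleton-Leq-bottom f c y@(y₀ ∷ ys) _ bc by = do
  D , D⊆ , D-max ← maxSublist (split c y) bPieces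
  [[],[]]≤D ← above D D⊆ D-max (All≤⊎Any> c y)
  pure (Leq-fold [ c ] y bc by (subst (λ L → LexMaxLeq f L (split c y)) (sym (split-replicate c 1))
          ([] ∷ [ [] ] , D , ⊆-refl , D⊆ , pair-Dominates , D-max , [[],[]]≤D)))
  where
  open ClassicalTotalPreorder (Leq-classical f)
  open Lexicographic (Leq-classical f) (suc c)
  bPieces = split-Band y by
  pair-Dominates : Dominates f ([] ∷ [ [] ]) ([] ∷ [ [] ])
  pair-Dominates S S⊆ =
    ≤⇒LexLeq-empties S _ (All-resp-⊆ S⊆ (refl ∷ refl ∷ [])) (refl ∷ refl ∷ []) (length-mono-≤ S⊆)
  -- Either a piece of y contains a letter above c, so it is strictly above [], or y = c ^ (1 + k) splits into ≥ 2 empty pieces.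
  above : ∀ D → D ⊆ split c y → Dominates f D (split c y) → All (_≤ c) y ⊎ Any (c <_) y →
          ¬ ¬ LexLeq f ([] ∷ [ [] ]) D
  above D _ D-max (inj₁ y≤c) =
    pure (D-max _ (subst ([] ∷ [ [] ] ⊆_) (sym (split-constant c y (Band-squeeze y y≤c by))) (refl ∷ refl ∷ minimum _)))
  above D D⊆ D-max (inj₂ y>c) = above-piece D D⊆ (D-max [ Y ] (from∈ Y∈))
    where
    found = find (split-Any c y y>c λ c<x x≡c → <-irrefl (sym x≡c) c<x)
    Y = proj₁ found
    Y∈ = proj₁ (proj₂ found)
    bY = All.head (All-resp-⊆ (from∈ Y∈) bPieces)
    above-piece : ∀ D → D ⊆ split c y → LexLeq f [ Y ] D → ¬ ¬ LexLeq f ([] ∷ [ [] ]) D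
    above-piece (d ∷ D) D⊆ Y≤D = do
      []≤d ← Leq-[]ˡ f d bd
      pure (inj₂ ([]≤d , λ d≤[] →
        Leq-trans Y d [] bY bd [] (LexLeq-head {f} {ys = D} Y≤D) d≤[] (Any-¬Leq-[] f Y (proj₂ (proj₂ found)) bY)))
      where bd = All.head (All-resp-⊆ D⊆ bPieces)

singleton-Leq : ∀ f {n} c y → n ≤ c → Any (c ≤_) y → Band n f [ c ] → Band n f y → ¬ ¬ Leq f [ c ] y
singleton-Leq zero    c y _ _ _ _ = pure tt
singleton-Leq (suc f) {n} c y n≤c big bc by with n ≟ c
... | yes refl = singleton-Leq-bottom f n y big bc by
... | no n≢c = do
  D , D⊆ , D-max ← maxSublist (split n y) bPieces
  [c]≤Y ← singleton-Leq f c Y n<c (proj₂ (proj₂ found)) bc′ bY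
  [c]≤[c] ← Leq-refl [ c ] bc′
  [[c]]≤D ← above D D⊆ (D-max [ Y ] (from∈ Y∈)) [c]≤Y
  pure (Leq-fold [ c ] y bc by (subst (λ L → LexMaxLeq f L (split n y)) (sym (split-avoiding n [ c ] c≢n))
          ([ [ c ] ] , D , ⊆-refl , D⊆ , singleton-Dominates [c]≤[c] , D-max , [[c]]≤D)))
  where
  open ClassicalTotalPreorder (Leq-classical f)
  open Lexicographic (Leq-classical f) (suc n)
  n<c = ≤∧≢⇒< n≤c n≢c
  c≢n = (n≢c ∘ sym) ∷ []
  bc′ = Band-shrink [ c ] bc c≢n
  bPieces = split-Band y by
  found = find (split-Any n y big (≢-below n<c))
  Y = proj₁ found
  Y∈ = proj₁ (proj₂ found)
  bY = All.head (All-resp-⊆ (from∈ Y∈) bPieces)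
  above : ∀ D → D ⊆ split n y → LexLeq f [ Y ] D → Leq f [ c ] Y → ¬ ¬ LexLeq f [ [ c ] ] D
  above (d ∷ D) D⊆ Y≤D [c]≤Y = do
    [c]≤d ← Leq-trans [ c ] Y d bc′ bY bd [c]≤Y (LexLeq-head {f} {ys = D} Y≤D)
    d≤[c]? ← ¬¬-excluded-middle
    pure (LexLeq-singleton {f} {[ c ]} {d} {D} [c]≤d d≤[c]?)
    where bd = All.head (All-resp-⊆ D⊆ bPieces)

Band-maxˡ : ∀ A B → Band 0 (suc (maxW (A ++ B))) A
Band-maxˡ A B = All≤⇒Band _ A (++⁻ˡ A (All-≤-maxW (A ++ B)))

Band-maxʳ : ∀ A B → Band 0 (suc (maxW (A ++ B))) B
Band-maxʳ A B = All≤⇒Band _ B (++⁻ʳ A (All-≤-maxW (A ++ B)))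

≾⇔Leq : ∀ M A B → Band 0 (suc M) A → Band 0 (suc M) B → A ≾ B ⇔ Leq (suc M) A B
≾⇔Leq M A B bA bB = Leq-fuel _ _ A B (Band-⊓ (Band-maxˡ A B) bA) (Band-⊓ (Band-maxʳ A B) bB)

≾-trans : ∀ A B C → A ≾ B → B ≾ C → ¬ ¬ (A ≾ C)
≾-trans A B C A≾B B≾C =
  Equivalence.from (≾⇔Leq M A C bA bC) <$>
  Leq-trans A B C bA bB bC (Equivalence.to (≾⇔Leq M A B bA bB) A≾B) (Equivalence.to (≾⇔Leq M B C bB bC) B≾C)
  where
  open ClassicalTotalPreorder (Leq-classical (suc (maxW (A ++ B ++ C))))
  M = maxW (A ++ B ++ C)
  ≤M = All-≤-maxW (A ++ B ++ C)
  bA = All≤⇒Band M A (++⁻ˡ A ≤M)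
  bB = All≤⇒Band M B (++⁻ˡ B (++⁻ʳ A ≤M))
  bC = All≤⇒Band M C (++⁻ʳ B (++⁻ʳ A ≤M))

≾-total : ∀ A B → ¬ ¬ (A ≾ B ⊎ B ≾ A)
≾-total A B =
  Sum.map (Equivalence.from (≾⇔Leq M A B bA bB)) (Equivalence.from (≾⇔Leq M B A bB bA)) <$>
  Leq-total A B bA bB
  where
  open ClassicalTotalPreorder (Leq-classical (suc (maxW (A ++ B))))
  M = maxW (A ++ B)
  bA = Band-maxˡ A B
  bB = Band-maxʳ A B

¬≺⇒≿ : ∀ {A B} → ¬ (A ≺ B) → ¬ ¬ (B ≾ A)
¬≺⇒≿ {A} {B} A⊀B B⋠A = ≾-total A B Sum.[ (λ A≾B → A⊀B (A≾B , B⋠A)) , B⋠A ]′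

≾-≺-trans : ∀ A B C → A ≾ B → B ≺ C → ¬ ¬ (A ≺ C)
≾-≺-trans A B C A≾B (B≾C , C⋠B) = do
  A≾C ← ≾-trans A B C A≾B B≾C
  pure (A≾C , λ C≾A → ≾-trans C A B C≾A A≾B C⋠B)

[]-≾ : ∀ X → ¬ ¬ ([] ≾ X)
[]-≾ X = Leq-[]ˡ _ X (Band-maxʳ [] X)

∷-⋠-[] : ∀ x xs → ¬ ((x ∷ xs) ≾ [])
∷-⋠-[] x xs = Leq-∷-[] _ (Band-maxˡ (x ∷ xs) [])

≺⇒[]≺ : ∀ A B → A ≺ B → ¬ ¬ ([] ≺ B)
≺⇒[]≺ A []       (_ , []⋠A) = contradiction []⋠A ([]-≾ A)
≺⇒[]≺ A (x ∷ xs) _          = do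
  []≾B ← []-≾ (x ∷ xs)
  pure ([]≾B , ∷-⋠-[] x xs)

replicate-⋠ : ∀ c k w → All (_≤ c) w → length w < k → ¬ (replicate k c ≾ w)
replicate-⋠ c k@(suc _) w w≤c |w|<k =
  ¬Leq-replicate _ c k w z≤n (s≤s z≤n) w≤c (inj₁ |w|<k) (Band-maxˡ (replicate k c) w) (Band-maxʳ (replicate k c) w)

[suc]-⋠ : ∀ c w → All (_≤ c) w → ¬ ([ suc c ] ≾ w)
[suc]-⋠ c w w≤c = ¬Leq-replicate _ (suc c) 1 w z≤n (s≤s z≤n) (All.map m≤n⇒m≤1+n w≤c) (inj₂ (All.map s≤s w≤c))
                    (Band-maxˡ [ suc c ] w) (Band-maxʳ [ suc c ] w)

[_]-≾ : ∀ c y → Any (c ≤_) y → ¬ ¬ ([ c ] ≾ y)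
[ c ]-≾ y big = singleton-Leq _ c y z≤n big (Band-maxˡ [ c ] y) (Band-maxʳ [ c ] y)

All≤⇒≺[suc] : ∀ c w → All (_≤ c) w → ¬ ¬ (w ≺ [ suc c ])
All≤⇒≺[suc] c w w≤c = do
  w≾[c+1] ← ¬≺⇒≿ {[ suc c ]} {w} (λ (c+1≾w , _) → [suc]-⋠ c w w≤c c+1≾w)
  pure (w≾[c+1] , [suc]-⋠ c w w≤c)

≾-All≤ : ∀ c w v → w ≾ v → All (_≤ c) v → All (_≤ c) w
≾-All≤ c w v w≾v v≤c with All≤⊎Any> c w
... | inj₁ w≤c = w≤c
... | inj₂ big = ⊥-elim (c+1≾v ([suc]-⋠ c v v≤c))
  where
  c+1≾v : ¬ ¬ ([ suc c ] ≾ v)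
  c+1≾v = do
    c+1≾w ← [ suc c ]-≾ w big
    ≾-trans [ suc c ] w v c+1≾w w≾v

≺[suc]⇒All≤ : ∀ c w → w ≺ [ suc c ] → All (_≤ c) w
≺[suc]⇒All≤ c w (_ , c+1⋠w) with All≤⊎Any> c w
... | inj₁ w≤c = w≤c
... | inj₂ big = ⊥-elim ([ suc c ]-≾ w big c+1⋠w)

minW-replicate : ∀ c j → minW c (replicate j c) ≡ c
minW-replicate c zero    = refl
minW-replicate c (suc j) rewrite minW-replicate c j = ⊓-idem c

replicate-∷ʳ : ∀ {A : Set} (c : A) j → replicate j c ++ [ c ] ≡ replicate (suc j) c
replicate-∷ʳ c zero    = refl
replicate-∷ʳ c (suc j) = cong (c ∷_) (replicate-∷ʳ c j)

empties-Linked : ∀ k → Linked (λ P Q → Q ≾ P) (replicate k [])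
empties-Linked zero          = []
empties-Linked (suc zero)    = [-]
empties-Linked (suc (suc k)) = tt ∷ empties-Linked (suc k)

replicate-NF : ∀ c j → NF (replicate j c)
replicate-NF c zero    = nfΛ
replicate-NF c (suc j) =
  nf∷ (subst (All NF) (sym pieces) (replicate⁺ _ nfΛ)) (subst (Linked _) (sym pieces) (empties-Linked _))
  where
  pieces : split (minW c (replicate j c)) (replicate (suc j) c) ≡ replicate (suc (suc j)) []
  pieces = trans (cong (λ m → split m (replicate (suc j) c)) (minW-replicate c j)) (split-replicate c (suc j))

InW-[] : ∀ α → InW α []
InW-[] (fin _) = []
InW-[] ω       = tt

InW-replicate-3 : ∀ {α} → ThreeLe α → ∀ j → InW α (replicate j 3)
InW-replicate-3 (le-fin 3≤a) j = replicate⁺ j 3≤a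
InW-replicate-3 le-ω         _ = tt

InW-singleton : ∀ {c} α X → InW α X → Any (c ≤_) X → InW α [ c ]
InW-singleton (fin _) (_ ∷ _) (x≤a ∷ _)  (here c≤x)  = ≤-trans c≤x x≤a ∷ []
InW-singleton (fin a) (_ ∷ X) (_ ∷ X≤a) (there big) = InW-singleton (fin a) X X≤a big
InW-singleton ω       _       _          _           = tt

-- The defining formula

x₀ : ∀ {n} → Term (suc n)
x₀ = var #0

x₁ : ∀ {n} → Term (suc (suc n))
x₁ = var (#suc #0)

below-◇₃-limits : Formula 1
below-◇₃-limits = ∀' ((∃' (x₀ ≺' x₁) ∧' ∀' ((x₀ ≺' x₁) ⇒' (◇₃ x₀ ≺' x₁))) ⇒' (x₁ ≺' x₀))

module _ {α : Bound} (α≥3 : ThreeLe α) (d₃ : Elem α → Elem α)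
         (d₃∼ : (A : Elem α) → word (d₃ A) ∼ (word A ++ [ 3 ])) where

  -- what Sat makes of the premise of below-◇₃-limits at z
  ◇₃-Limit : Elem α → Set
  ◇₃-Limit z = ¬ ((y : Elem α) → ¬ ¬ ¬ (word y ≺ word z))
             × ((y : Elem α) → ¬ ¬ (word y ≺ word z) → ¬ ¬ (word (d₃ y) ≺ word z))

  3^ : ℕ → Elem α
  3^ j = elem (replicate j 3) (replicate-NF 3 j) (InW-replicate-3 α≥3 j)

  replicate-≺-limit : ∀ z → ◇₃-Limit z → ∀ j → ¬ ¬ (replicate j 3 ≺ word z)
  replicate-≺-limit z (nonzero , _) zero ¬[]≺z =
    nonzero λ y ¬¬y≺z → ¬¬y≺z λ y≺z → ≺⇒[]≺ (word y) (word z) y≺z ¬[]≺z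
  replicate-≺-limit z limit@(_ , closed) (suc j) = do
    3ʲ≺z ← replicate-≺-limit z limit j
    ◇₃3ʲ≺z ← closed (3^ j) (pure 3ʲ≺z)
    ≾-≺-trans (replicate (suc j) 3) (word (d₃ (3^ j))) (word z)
      (subst (_≾ word (d₃ (3^ j))) (replicate-∷ʳ 3 j) (proj₂ (d₃∼ (3^ j)))) ◇₃3ʲ≺z

  W₃-≺-limits : (x : Elem α) → All (_≤ 3) (word x) → (z : Elem α) → ◇₃-Limit z → ¬ ¬ (word x ≺ word z)
  W₃-≺-limits x x≤3 z limit x⊀z = ¬≺⇒≿ x⊀z λ z≾x →
    replicate-≺-limit z limit (suc (length (word z))) λ (3ᵏ≾z , _) →
      replicate-⋠ 3 _ (word z) (≾-All≤ 3 (word z) (word x) z≾x x≤3) ≤-refl 3ᵏ≾z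

  [4]ₑ : InW α [ 4 ] → Elem α
  [4]ₑ = elem [ 4 ] (replicate-NF 4 1)

  [4]-Limit : (4∈W : InW α [ 4 ]) → ◇₃-Limit ([4]ₑ 4∈W)
  [4]-Limit _ = (λ nothing-below → nothing-below Λ (All≤⇒≺[suc] 3 [] [])) , closed
    where
    Λ = elem [] nfΛ (InW-[] α)
    closed : ∀ y → ¬ ¬ (word y ≺ [ 4 ]) → ¬ ¬ (word (d₃ y) ≺ [ 4 ])
    closed y ¬¬y≺4 = ¬¬y≺4 >>= λ y≺4 →
      All≤⇒≺[suc] 3 (word (d₃ y))
        (≾-All≤ 3 _ _ (proj₁ (d₃∼ y)) (++⁺ (≺[suc]⇒All≤ 3 (word y) y≺4) (≤-refl ∷ [])))

  ≺-limits⇒W₃ : (x : Elem α) → ((z : Elem α) → ◇₃-Limit z → ¬ ¬ (word x ≺ word z)) → All (_≤ 3) (word x)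
  ≺-limits⇒W₃ x below with All≤⊎Any> 3 (word x)
  ... | inj₁ x≤3 = x≤3
  ... | inj₂ big = ⊥-elim (below ([4]ₑ 4∈W) ([4]-Limit 4∈W)
                             λ (_ , 4⋠x) → [ 4 ]-≾ (word x) big 4⋠x)
    where 4∈W = InW-singleton α (word x) (inW x) big

lemma5 : (α : Bound) → ThreeLe α →
         (d₁ d₃ : Elem α → Elem α) →
         ((A : Elem α) → word (d₁ A) ∼ (word A ++ [ 1 ])) →
         ((A : Elem α) → word (d₃ A) ∼ (word A ++ [ 3 ])) →
         Definable (WStr α d₁ d₃) (λ A → InW (fin 3) (word A))
lemma5 α α≥3 _ d₃ _ d₃∼ =
  below-◇₃-limits , λ x → W₃-≺-limits α≥3 d₃ d₃∼ x , ≺-limits⇒W₃ α≥3 d₃ d₃∼ x
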